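{- Let $q$ be an even prime power and let $G=(V,E)$ be a graph representation (over $GF(q)$) with $n$ vertices and $m$ edges. Then for all integers $x\ge 0$ and $z\ge 0$, $$u^G_{x+z}\ge u^G_x\binom{m-x}{z}\Big/\binom{x+z}{z}.$$
   Context: Graph representation of a coding scheme on packets $p_1,\dots,p_n\in GF(q)^\ell$ ($n\ge2$): vertices $p_1,\dots,p_n$, an edge joining $p_j,p_k$ per encoding $p_j+p_k$ ($j\ne k$), a loop at $p_j$ per encoding $p_j$ (multigraph, edges labelled distinctly). A spanning subgraph is decodable if the encodings of its edges determine $p_1,\dots,p_n$ uniquely, otherwise undecodable. For an integer $x$, $c^G_x$ is the number of $x$-element subsets $X\subseteq E$ with $(V,E\setminus X)$ decodable ($c^G_x=0$ if $x<0$ or $x>m$), and $u^G_x=\binom{m}{x}-c^G_x$; binomial coefficients $\binom{a}{b}$ are $0$ when $b>a$. -}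

module Defs where

open import Level using (Level; _⊔_)
open import Data.Nat using (ℕ)
open import Data.Fin using (Fin)
open import Data.Fin.Subset using (Subset; _∉_; ∣_∣)
open import Data.List using (List; length)
open import Data.List.Membership.Propositional using (_∈_)
open import Data.List.Relation.Unary.Unique.Propositional using (Unique)
open import Data.Product using (Σ; ∃; _×_)
open import Relation.Nullary using (¬_)
open import Relation.Binary.PropositionalEquality using (_≡_; _≢_) renaming (setoid to ≡-setoid)
open import Algebra.Bundles using (CommutativeRing)
open import Function.Bundles using (Inverse; _⇔_)

record IsFiniteField {c ℓ : Level} (F : CommutativeRing c ℓ) (q : ℕ) : Set (c ⊔ ℓ) where
  open CommutativeRing F
  field
    one≉zero   : ¬ (1# ≈ 0#)
    inverse    : ∀ x → ¬ (x ≈ 0#) → Σ Carrier (λ y → (x * y) ≈ 1#)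
    enumerate  : Inverse setoid (≡-setoid (Fin q))

-- Edges of a graph representation on n vertices:
-- a loop at p_j encodes p_j, a link between p_j and p_k (j ≠ k) encodes p_j + p_k.
data Edge (n : ℕ) : Set where
  loop : Fin n → Edge n
  link : (j k : Fin n) → j ≢ k → Edge n

Graph : ℕ → ℕ → Set
Graph n m = Fin m → Edge n

module _ {c ℓ : Level} (F : CommutativeRing c ℓ) (len : ℕ) where
  open CommutativeRing F

  Packets : ℕ → Set c
  Packets n = Fin n → Fin len → Carrier

  encode : ∀ {n} → Edge n → Packets n → Fin len → Carrier
  encode (loop j)     p i = p j i
  encode (link j k _) p i = p j i + p k i

  DecodableAfterRemoving : ∀ {n m} → Graph n m → Subset m → Set (c ⊔ ℓ)
  DecodableAfterRemoving {n} {m} G X =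
    (p p' : Packets n) →
    (∀ (e : Fin m) → e ∉ X → ∀ i → encode (G e) p i ≈ encode (G e) p' i) →
    ∀ j i → p j i ≈ p' j i

  -- k is the number c^G_x of x-element subsets X ⊆ E with (V, E \ X) decodable:
  -- these subsets are exactly the entries of a duplicate-free list of length k.
  IsDecodableCount : ∀ {n m} → Graph n m → ℕ → ℕ → Set (c ⊔ ℓ)
  IsDecodableCount {n} {m} G x k =
    ∃ λ (xs : List (Subset m)) →
      Unique xs × length xs ≡ k ×
      (∀ X → X ∈ xs ⇔ (∣ X ∣ ≡ x × DecodableAfterRemoving G X))

-- Removing fewer edges keeps a subgraph decodable, so the edge sets X whose removal leaves an
-- undecodable subgraph form an up-set in the lattice of subsets of E.  Double count the pairs
-- X ⊆ Y with X such a set, ∣X∣ = x and ∣Y∣ = x + z: every such X lies in (m − x choose z) sets Y,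
-- and every Y (itself such a set) contains at most (x + z choose x) sets X.
module Submission where

open import Defs
open import Level using (Level)
open import Data.Nat using (ℕ; _≤_; _*_; _∸_; _+_)
open import Data.Nat.Divisibility using (_∣_)
open import Data.Nat.Combinatorics using (_C_)
open import Algebra.Bundles using (CommutativeRing)

open import Function using (_∘_)
open import Data.Bool using (if_then_else_)
import Data.Bool.Properties as Bool
open import Data.Nat using (zero; suc; z≤n; s≤s; _≟_)
open import Data.Nat.Properties
open import Data.Nat.Combinatorics using (nCk≡nC[n∸k]; nCk+nC[k+1]≡[n+1]C[k+1])
open import Data.Fin.Subset using (Subset; _⊆_; ⊤; inside; outside; ∣_∣)
open import Data.Fin.Subset.Properties using (_⊆?_; ⊆⊤; ∣⊤∣≡n; ∣p∣≤n; p⊆q⇒∣p∣≤∣q∣)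
open import Data.Vec using ([]; _∷_)
open import Data.Vec.Properties using (≡-dec)
open import Data.List using (List; _∷_; length)
open import Data.List.Relation.Unary.Any using (any?)
open import Data.List.Membership.Propositional using (_∈_; _∉_)
open import Data.List.Relation.Unary.All.Properties using (All¬⇒¬Any)
open import Data.List.Relation.Unary.AllPairs using ([]; _∷_)
open import Data.List.Relation.Unary.Unique.Propositional using (Unique)
open import Data.Product using (_×_; _,_; proj₁; proj₂)
open import Function.Bundles using (_⇔_; module Equivalence)
open import Relation.Nullary using (Dec; yes; no; does; ¬_; contradiction)
open import Relation.Nullary.Decidable using (_×-dec_; dec-true; dec-false)
open import Relation.Binary.PropositionalEquality
open import Algebra.Properties.CommutativeSemigroup +-commutativeSemigroup using (interchange)

private
  variable
    ℓ₁ ℓ₂ : Level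
    P : Set ℓ₁
    Q : Set ℓ₂
    m : ℕ

𝟙 : Dec P → ℕ
𝟙 P? = if does P? then 1 else 0

𝟙-yes : (P? : Dec P) → P → 𝟙 P? ≡ 1
𝟙-yes P? x rewrite dec-true P? x = refl

𝟙-no : (P? : Dec P) → ¬ P → 𝟙 P? ≡ 0
𝟙-no P? ¬x rewrite dec-false P? ¬x = refl

𝟙-×-dec : (P? : Dec P) (Q? : Dec Q) → 𝟙 (P? ×-dec Q?) ≡ 𝟙 P? * 𝟙 Q?
𝟙-×-dec (yes _) (yes _) = refl
𝟙-×-dec (yes _) (no _)  = refl
𝟙-×-dec (no _)  _       = refl

𝟙-mono : (P? : Dec P) (Q? : Dec Q) → (P → Q) → 𝟙 P? ≤ 𝟙 Q?
𝟙-mono (yes x) Q? P→Q = ≤-reflexive (sym (𝟙-yes Q? (P→Q x)))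
𝟙-mono (no _)  Q? P→Q = z≤n

𝟙-*-cong : (P? : Dec P) {a b : ℕ} → (P → a ≡ b) → 𝟙 P? * a ≡ 𝟙 P? * b
𝟙-*-cong (yes x) P→a≡b = cong (1 *_) (P→a≡b x)
𝟙-*-cong (no _)  P→a≡b = refl

∑ : ∀ m → (Subset m → ℕ) → ℕ
∑ zero    f = f []
∑ (suc m) f = ∑ m (f ∘ (inside ∷_)) + ∑ m (f ∘ (outside ∷_))

∑-cong : ∀ m {f g : Subset m → ℕ} → (∀ X → f X ≡ g X) → ∑ m f ≡ ∑ m g
∑-cong zero    f≗g = f≗g []
∑-cong (suc m) f≗g = cong₂ _+_ (∑-cong m (f≗g ∘ (inside ∷_))) (∑-cong m (f≗g ∘ (outside ∷_)))

∑-mono-≤ : ∀ m {f g : Subset m → ℕ} → (∀ X → f X ≤ g X) → ∑ m f ≤ ∑ m g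
∑-mono-≤ zero    f≤g = f≤g []
∑-mono-≤ (suc m) f≤g = +-mono-≤ (∑-mono-≤ m (f≤g ∘ (inside ∷_))) (∑-mono-≤ m (f≤g ∘ (outside ∷_)))

∑-zero : ∀ m → ∑ m (λ _ → 0) ≡ 0
∑-zero zero    = refl
∑-zero (suc m) = cong₂ _+_ (∑-zero m) (∑-zero m)

∑-distrib-+ : ∀ m (f g : Subset m → ℕ) → ∑ m (λ X → f X + g X) ≡ ∑ m f + ∑ m g
∑-distrib-+ zero    f g = refl
∑-distrib-+ (suc m) f g = begin
  ∑ m (λ X → f (inside ∷ X) + g (inside ∷ X)) + ∑ m (λ X → f (outside ∷ X) + g (outside ∷ X))
    ≡⟨ cong₂ _+_ (∑-distrib-+ m _ _) (∑-distrib-+ m _ _) ⟩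
  (∑ m (f ∘ (inside ∷_)) + ∑ m (g ∘ (inside ∷_))) + (∑ m (f ∘ (outside ∷_)) + ∑ m (g ∘ (outside ∷_)))
    ≡⟨ interchange (∑ m (f ∘ (inside ∷_))) _ _ _ ⟩
  ∑ (suc m) f + ∑ (suc m) g ∎
  where open ≡-Reasoning

∑-distribʳ-* : ∀ m (f : Subset m → ℕ) k → ∑ m (λ X → f X * k) ≡ ∑ m f * k
∑-distribʳ-* zero    f k = refl
∑-distribʳ-* (suc m) f k =
  trans (cong₂ _+_ (∑-distribʳ-* m _ k) (∑-distribʳ-* m _ k))
        (sym (*-distribʳ-+ k (∑ m (f ∘ (inside ∷_))) (∑ m (f ∘ (outside ∷_)))))

∑-distribˡ-* : ∀ m (f : Subset m → ℕ) k → ∑ m (λ X → k * f X) ≡ k * ∑ m f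
∑-distribˡ-* m f k =
  trans (∑-cong m (λ X → *-comm k (f X))) (trans (∑-distribʳ-* m f k) (*-comm (∑ m f) k))

∑-comm : ∀ m n (f : Subset m → Subset n → ℕ) →
         ∑ m (λ X → ∑ n (f X)) ≡ ∑ n (λ Y → ∑ m (λ X → f X Y))
∑-comm zero    n f = refl
∑-comm (suc m) n f =
  trans (cong₂ _+_ (∑-comm m n (f ∘ (inside ∷_))) (∑-comm m n (f ∘ (outside ∷_))))
        (sym (∑-distrib-+ n _ _))

∑-supersets : (X : Subset m) (z : ℕ) →
              ∑ m (λ Y → 𝟙 (X ⊆? Y ×-dec ∣ Y ∣ ≟ ∣ X ∣ + z)) ≡ (m ∸ ∣ X ∣) C z
∑-supersets []             zero    = refl
∑-supersets []             (suc z) = refl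
∑-supersets {suc m} (inside ∷ X) z =
  trans (cong₂ _+_ (∑-supersets X z) (∑-zero m)) (+-identityʳ _)
∑-supersets {suc m} (outside ∷ X) zero =
  cong₂ _+_ (trans (∑-cong m λ Y → 𝟙-no (X ⊆? Y ×-dec suc ∣ Y ∣ ≟ ∣ X ∣ + 0) (too-small Y)) (∑-zero m))
            (∑-supersets X 0)
  where
  too-small : ∀ Y → ¬ (X ⊆ Y × suc ∣ Y ∣ ≡ ∣ X ∣ + 0)
  too-small Y (X⊆Y , eq) = <-irrefl (sym (trans eq (+-identityʳ _))) (s≤s (p⊆q⇒∣p∣≤∣q∣ X⊆Y))
∑-supersets {suc m} (outside ∷ X) (suc z) = begin
  ∑ m (λ Y → 𝟙 (X ⊆? Y ×-dec suc ∣ Y ∣ ≟ ∣ X ∣ + suc z)) + ∑ m (grow (suc z))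
    ≡⟨ cong (_+ ∑ m (grow (suc z))) (∑-cong m λ Y → cong (λ k → 𝟙 (X ⊆? Y ×-dec suc ∣ Y ∣ ≟ k)) (+-suc ∣ X ∣ z)) ⟩
  ∑ m (grow z) + ∑ m (grow (suc z))
    ≡⟨ cong₂ _+_ (∑-supersets X z) (∑-supersets X (suc z)) ⟩
  (m ∸ ∣ X ∣) C z + (m ∸ ∣ X ∣) C suc z
    ≡⟨ nCk+nC[k+1]≡[n+1]C[k+1] (m ∸ ∣ X ∣) z ⟩
  suc (m ∸ ∣ X ∣) C suc z
    ≡⟨ cong (_C suc z) (+-∸-assoc 1 (∣p∣≤n X)) ⟨
  (suc m ∸ ∣ X ∣) C suc z ∎
  where
  open ≡-Reasoning
  grow : ℕ → Subset m → ℕ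
  grow k Y = 𝟙 (X ⊆? Y ×-dec ∣ Y ∣ ≟ ∣ X ∣ + k)

∑-subsets : (Y : Subset m) (k : ℕ) → ∑ m (λ X → 𝟙 (X ⊆? Y ×-dec ∣ X ∣ ≟ k)) ≡ ∣ Y ∣ C k
∑-subsets []             zero    = refl
∑-subsets []             (suc k) = refl
∑-subsets {suc m} (inside ∷ Y) zero =
  cong₂ _+_ (trans (∑-cong m λ X → 𝟙-no (X ⊆? Y ×-dec suc ∣ X ∣ ≟ 0) λ ()) (∑-zero m)) (∑-subsets Y 0)
∑-subsets {suc m} (inside ∷ Y) (suc k) =
  trans (cong₂ _+_ (∑-subsets Y k) (∑-subsets Y (suc k))) (nCk+nC[k+1]≡[n+1]C[k+1] ∣ Y ∣ k)
∑-subsets {suc m} (outside ∷ Y) k = cong₂ _+_ (∑-zero m) (∑-subsets Y k)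

∑-supersets-of-size : (X : Subset m) {k : ℕ} → ∣ X ∣ ≡ k → ∀ z →
                      ∑ m (λ Y → 𝟙 (X ⊆? Y ×-dec ∣ Y ∣ ≟ k + z)) ≡ (m ∸ k) C z
∑-supersets-of-size X refl z = ∑-supersets X z

∑-subsets-of-size : (Y : Subset m) → ∀ x z → ∣ Y ∣ ≡ x + z →
                    ∑ m (λ X → 𝟙 (X ⊆? Y ×-dec ∣ X ∣ ≟ x)) ≡ (x + z) C z
∑-subsets-of-size {m} Y x z ∣Y∣≡x+z = begin
  ∑ m (λ X → 𝟙 (X ⊆? Y ×-dec ∣ X ∣ ≟ x)) ≡⟨ ∑-subsets Y x ⟩
  ∣ Y ∣ C x                              ≡⟨ cong (_C x) ∣Y∣≡x+z ⟩
  (x + z) C x                            ≡⟨ nCk≡nC[n∸k] (m≤m+n x z) ⟩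
  (x + z) C (x + z ∸ x)                  ≡⟨ cong ((x + z) C_) (m+n∸m≡n x z) ⟩
  (x + z) C z ∎
  where open ≡-Reasoning

∑-layer : ∀ m k → ∑ m (λ X → 𝟙 (∣ X ∣ ≟ k)) ≡ m C k
∑-layer m k = begin
  ∑ m (λ X → 𝟙 (∣ X ∣ ≟ k))              ≡⟨ ∑-cong m within-⊤ ⟨
  ∑ m (λ X → 𝟙 (X ⊆? ⊤ ×-dec ∣ X ∣ ≟ k)) ≡⟨ ∑-subsets {m} ⊤ k ⟩
  ∣ ⊤ {m} ∣ C k                           ≡⟨ cong (_C k) (∣⊤∣≡n m) ⟩
  m C k ∎
  where
  open ≡-Reasoning
  within-⊤ : ∀ X → 𝟙 (X ⊆? ⊤ ×-dec ∣ X ∣ ≟ k) ≡ 𝟙 (∣ X ∣ ≟ k)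
  within-⊤ X = trans (𝟙-×-dec (X ⊆? ⊤) (∣ X ∣ ≟ k))
                     (trans (cong (_* 𝟙 (∣ X ∣ ≟ k)) (𝟙-yes (X ⊆? ⊤) ⊆⊤)) (*-identityˡ _))

infix 4 _≟ˢ_ _∈ˢ?_

_≟ˢ_ : (X Y : Subset m) → Dec (X ≡ Y)
_≟ˢ_ = ≡-dec Bool._≟_

_∈ˢ?_ : (X : Subset m) (xs : List (Subset m)) → Dec (X ∈ xs)
X ∈ˢ? xs = any? (X ≟ˢ_) xs

∑-≟ˢ : (Y : Subset m) → ∑ m (λ X → 𝟙 (X ≟ˢ Y)) ≡ 1
∑-≟ˢ []                    = refl
∑-≟ˢ {suc m} (inside ∷ Y)  = trans (cong₂ _+_ (∑-≟ˢ Y) (∑-zero m)) (+-identityʳ 1)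
∑-≟ˢ {suc m} (outside ∷ Y) = cong₂ _+_ (∑-zero m) (∑-≟ˢ Y)

𝟙-∈-∷ : {y : Subset m} {ys : List (Subset m)} → y ∉ ys →
        ∀ X → 𝟙 (X ∈ˢ? y ∷ ys) ≡ 𝟙 (X ≟ˢ y) + 𝟙 (X ∈ˢ? ys)
𝟙-∈-∷ {y = y} {ys} y∉ys X with X ≟ˢ y
... | yes refl = cong suc (sym (𝟙-no (X ∈ˢ? ys) y∉ys))
... | no _     = refl

∑-∈ : {xs : List (Subset m)} → Unique xs → ∑ m (λ X → 𝟙 (X ∈ˢ? xs)) ≡ length xs
∑-∈ {m} []                   = ∑-zero m
∑-∈ {m} {y ∷ ys} (y∉ys ∷ ys!) = begin
  ∑ m (λ X → 𝟙 (X ∈ˢ? y ∷ ys))                       ≡⟨ ∑-cong m (𝟙-∈-∷ (All¬⇒¬Any y∉ys)) ⟩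
  ∑ m (λ X → 𝟙 (X ≟ˢ y) + 𝟙 (X ∈ˢ? ys))              ≡⟨ ∑-distrib-+ m _ _ ⟩
  ∑ m (λ X → 𝟙 (X ≟ˢ y)) + ∑ m (λ X → 𝟙 (X ∈ˢ? ys)) ≡⟨ cong₂ _+_ (∑-≟ˢ y) (∑-∈ ys!) ⟩
  suc (length ys) ∎
  where open ≡-Reasoning

Layer : ∀ {ℓ} → ℕ → (Subset m → Set ℓ) → Subset m → Set ℓ
Layer x P X = ∣ X ∣ ≡ x × P X

module _ {ℓ} {D : Subset m → Set ℓ} {x : ℕ} {xs : List (Subset m)}
         (xs↔ : ∀ X → X ∈ xs ⇔ Layer x D X) where
  open Equivalence

  -- D need not be decidable: on the layer, membership in the listing decides it.
  layer-complement? : ∀ X → Dec (Layer x (¬_ ∘ D) X)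
  layer-complement? X with ∣ X ∣ ≟ x | X ∈ˢ? xs
  ... | no ∣X∣≢x  | _        = no (∣X∣≢x ∘ proj₁)
  ... | yes _     | yes X∈xs = no λ (_ , ¬DX) → ¬DX (proj₂ (to (xs↔ X) X∈xs))
  ... | yes ∣X∣≡x | no X∉xs = yes (∣X∣≡x , λ DX → X∉xs (from (xs↔ X) (∣X∣≡x , DX)))

  𝟙-layer-split : ∀ X → 𝟙 (∣ X ∣ ≟ x) ≡ 𝟙 (X ∈ˢ? xs) + 𝟙 (layer-complement? X)
  𝟙-layer-split X with ∣ X ∣ ≟ x | X ∈ˢ? xs
  ... | no ∣X∣≢x  | yes X∈xs = contradiction (proj₁ (to (xs↔ X) X∈xs)) ∣X∣≢x
  ... | no ∣X∣≢x  | no _     = 𝟙-no (∣ X ∣ ≟ x) ∣X∣≢x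
  ... | yes ∣X∣≡x | yes _    = 𝟙-yes (∣ X ∣ ≟ x) ∣X∣≡x
  ... | yes ∣X∣≡x | no _     = 𝟙-yes (∣ X ∣ ≟ x) ∣X∣≡x

  ∑-layer-complement : Unique xs → ∑ m (𝟙 ∘ layer-complement?) ≡ m C x ∸ length xs
  ∑-layer-complement xs! = begin
    ∑ m (𝟙 ∘ layer-complement?)
      ≡⟨ m+n∸m≡n (length xs) _ ⟨
    length xs + ∑ m (𝟙 ∘ layer-complement?) ∸ length xs
      ≡⟨ cong (λ k → k + ∑ m (𝟙 ∘ layer-complement?) ∸ length xs) (∑-∈ xs!) ⟨
    ∑ m (λ X → 𝟙 (X ∈ˢ? xs)) + ∑ m (𝟙 ∘ layer-complement?) ∸ length xs
      ≡⟨ cong (_∸ length xs) (∑-distrib-+ m _ _) ⟨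
    ∑ m (λ X → 𝟙 (X ∈ˢ? xs) + 𝟙 (layer-complement? X)) ∸ length xs
      ≡⟨ cong (_∸ length xs) (∑-cong m 𝟙-layer-split) ⟨
    ∑ m (λ X → 𝟙 (∣ X ∣ ≟ x)) ∸ length xs
      ≡⟨ cong (_∸ length xs) (∑-layer m x) ⟩
    m C x ∸ length xs ∎
    where open ≡-Reasoning

upwardClosed⇒layer-count-≤ :
  ∀ {ℓ} {U : Subset m → Set ℓ} → (∀ {X Y} → X ⊆ Y → U X → U Y) →
  ∀ x z (A? : ∀ X → Dec (Layer x U X)) (B? : ∀ Y → Dec (Layer (x + z) U Y)) →
  ∑ m (𝟙 ∘ A?) * ((m ∸ x) C z) ≤ ∑ m (𝟙 ∘ B?) * ((x + z) C z)
upwardClosed⇒layer-count-≤ {m} {U = U} U-up x z A? B? = begin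
  ∑ m a * K                              ≡⟨ ∑-distribʳ-* m a K ⟨
  ∑ m (λ X → a X * K)                    ≡⟨ ∑-cong m count-supersets ⟩
  ∑ m (λ X → a X * ∑ m (sup X))          ≡⟨ ∑-cong m (λ X → ∑-distribˡ-* m (sup X) (a X)) ⟨
  ∑ m (λ X → ∑ m (λ Y → a X * sup X Y))  ≡⟨ ∑-comm m m _ ⟩
  ∑ m (λ Y → ∑ m (λ X → a X * sup X Y))  ≤⟨ ∑-mono-≤ m (λ Y → ∑-mono-≤ m (λ X → pair-bound X Y)) ⟩
  ∑ m (λ Y → ∑ m (λ X → b Y * sub X Y))  ≡⟨ ∑-cong m (λ Y → ∑-distribˡ-* m (λ X → sub X Y) (b Y)) ⟩
  ∑ m (λ Y → b Y * ∑ m (λ X → sub X Y))  ≡⟨ ∑-cong m count-subsets ⟩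
  ∑ m (λ Y → b Y * K′)                   ≡⟨ ∑-distribʳ-* m b K′ ⟩
  ∑ m b * K′ ∎
  where
  open ≤-Reasoning
  K K′ : ℕ
  K  = (m ∸ x) C z
  K′ = (x + z) C z
  a b : Subset m → ℕ
  a = 𝟙 ∘ A?
  b = 𝟙 ∘ B?
  sup sub : Subset m → Subset m → ℕ
  sup X Y = 𝟙 (X ⊆? Y ×-dec ∣ Y ∣ ≟ x + z)
  sub X Y = 𝟙 (X ⊆? Y ×-dec ∣ X ∣ ≟ x)

  count-supersets : ∀ X → a X * K ≡ a X * ∑ m (sup X)
  count-supersets X = 𝟙-*-cong (A? X) λ (∣X∣≡x , _) → sym (∑-supersets-of-size X ∣X∣≡x z)

  count-subsets : ∀ Y → b Y * ∑ m (λ X → sub X Y) ≡ b Y * K′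
  count-subsets Y = 𝟙-*-cong (B? Y) λ (∣Y∣≡x+z , _) → ∑-subsets-of-size Y x z ∣Y∣≡x+z

  pair-bound : ∀ X Y → a X * sup X Y ≤ b Y * sub X Y
  pair-bound X Y = begin
    a X * sup X Y           ≡⟨ 𝟙-×-dec (A? X) supsets? ⟨
    𝟙 (A? X ×-dec supsets?) ≤⟨ 𝟙-mono (A? X ×-dec supsets?) (B? Y ×-dec subsets?) upward ⟩
    𝟙 (B? Y ×-dec subsets?) ≡⟨ 𝟙-×-dec (B? Y) subsets? ⟩
    b Y * sub X Y           ∎
    where
    supsets? : Dec (X ⊆ Y × ∣ Y ∣ ≡ x + z)
    supsets? = X ⊆? Y ×-dec ∣ Y ∣ ≟ x + z
    subsets? : Dec (X ⊆ Y × ∣ X ∣ ≡ x)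
    subsets? = X ⊆? Y ×-dec ∣ X ∣ ≟ x
    upward : Layer x U X × X ⊆ Y × ∣ Y ∣ ≡ x + z → Layer (x + z) U Y × X ⊆ Y × ∣ X ∣ ≡ x
    upward ((∣X∣≡x , UX) , X⊆Y , ∣Y∣≡x+z) = (∣Y∣≡x+z , U-up X⊆Y UX) , X⊆Y , ∣X∣≡x

decodable-antitone : ∀ {c ℓ} (F : CommutativeRing c ℓ) len {n m} (G : Graph n m) {X Y : Subset m} →
                     X ⊆ Y → DecodableAfterRemoving F len G Y → DecodableAfterRemoving F len G X
decodable-antitone F len G X⊆Y decY p p′ agree = decY p p′ λ e e∉Y → agree e (e∉Y ∘ X⊆Y)

lemma10 : {c ℓ : Level} (F : CommutativeRing c ℓ) (q : ℕ) → IsFiniteField F q → 2 ∣ q →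
          (len n m : ℕ) → 2 ≤ n → (G : Graph n m) →
          (x z cx cxz : ℕ) →
          IsDecodableCount F len G x cx →
          IsDecodableCount F len G (x + z) cxz →
          ((m C x) ∸ cx) * ((m ∸ x) C z) ≤ ((m C (x + z)) ∸ cxz) * ((x + z) C z)
lemma10 F _ _ _ len _ m _ G x z cx cxz (xs , xs! , refl , xs↔) (ys , ys! , refl , ys↔) = begin
  (m C x ∸ length xs) * ((m ∸ x) C z)
    ≡⟨ cong (_* ((m ∸ x) C z)) (∑-layer-complement xs↔ xs!) ⟨
  ∑ m (𝟙 ∘ layer-complement? xs↔) * ((m ∸ x) C z)
    ≤⟨ upwardClosed⇒layer-count-≤ undecodable-upward x z (layer-complement? xs↔) (layer-complement? ys↔) ⟩
  ∑ m (𝟙 ∘ layer-complement? ys↔) * ((x + z) C z)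
    ≡⟨ cong (_* ((x + z) C z)) (∑-layer-complement ys↔ ys!) ⟩
  (m C (x + z) ∸ length ys) * ((x + z) C z) ∎
  where
  open ≤-Reasoning
  undecodable-upward : ∀ {X Y} → X ⊆ Y →
                       ¬ DecodableAfterRemoving F len G X → ¬ DecodableAfterRemoving F len G Y
  undecodable-upward X⊆Y ¬decX = ¬decX ∘ decodable-antitone F len G X⊆Y
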